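{- Let $V$ be the three-element poset consisting of one element below two incomparable elements. There exists a nine-element poset $P$ such that the maximum size of a semiantichain in $P\times V$ is $12$ while every unichain covering of $P\times V$ has at least $13$ unichains. In particular, there are finite posets $P,Q$ for which the maximum size of a semiantichain of $P\times Q$ is strictly smaller than the minimum size of a unichain covering of $P\times Q$.
   Context: The product $P\times Q$ is ordered by $(u,x)\le(v,y)$ iff $u\le_P v$ and $x\le_Q y$. A unichain is a chain of the form $\{p\}\times C'$ ($C'$ a chain of $Q$) or $C\times\{q\}$ ($C$ a chain of $P$); a unichain covering is a family of unichains whose union is $P\times Q$; a semiantichain is a set $S\subseteq P\times Q$ no two distinct elements of which lie in a common unichain. -}

module Defs where

open import Data.Nat using (ℕ; zero; suc; _≤_; _<_)
open import Data.Fin using (Fin; zero; suc)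
open import Data.Bool using (Bool; true; false; T)
open import Data.Unit using (tt)
open import Data.Product using (Σ; _×_; _,_; proj₁; proj₂; ∃-syntax)
open import Data.Sum using (_⊎_)
open import Data.List using (List; length)
open import Data.List.Relation.Unary.All using (All)
open import Data.List.Relation.Unary.Any using (Any)
open import Data.List.Membership.Propositional using (_∈_)
open import Data.List.Relation.Unary.Unique.Propositional using (Unique)
open import Relation.Binary.PropositionalEquality using (_≡_; _≢_)
open import Relation.Nullary using (¬_)

-- A finite poset on the carrier Fin n, with a (decidable, Bool-valued) order.
-- (Every finite poset is isomorphic to one of these.)
record FinPoset (n : ℕ) : Set where
  field
    le      : Fin n → Fin n → Bool
    refl    : ∀ x → T (le x x)
    antisym : ∀ x y → T (le x y) → T (le y x) → x ≡ y
    trans   : ∀ x y z → T (le x y) → T (le y z) → T (le x z)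

open FinPoset public

_≼[_]_ : ∀ {n} → Fin n → FinPoset n → Fin n → Set
x ≼[ P ] y = T (le P x y)

Comparable : ∀ {n} → FinPoset n → Fin n → Fin n → Set
Comparable P x y = x ≼[ P ] y ⊎ y ≼[ P ] x

Elt : ℕ → ℕ → Set
Elt n m = Fin n × Fin m

ProdLe : ∀ {n m} → FinPoset n → FinPoset m → Elt n m → Elt n m → Set
ProdLe P Q (u , x) (v , y) = (u ≼[ P ] v) × (x ≼[ Q ] y)

SubsetPQ : ℕ → ℕ → Set
SubsetPQ n m = Elt n m → Bool

_∈ₛ_ : ∀ {n m} → Elt n m → SubsetPQ n m → Set
z ∈ₛ U = T (U z)

IsUnichain : ∀ {n m} → FinPoset n → FinPoset m → SubsetPQ n m → Set
IsUnichain {n} {m} P Q U =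
  ( (Σ (Fin n) λ p → ∀ z → z ∈ₛ U → proj₁ z ≡ p)
    × (∀ z w → z ∈ₛ U → w ∈ₛ U → Comparable Q (proj₂ z) (proj₂ w)) )
  ⊎
  ( (Σ (Fin m) λ q → ∀ z → z ∈ₛ U → proj₂ z ≡ q)
    × (∀ z w → z ∈ₛ U → w ∈ₛ U → Comparable P (proj₁ z) (proj₁ w)) )

IsSemiantichain : ∀ {n m} → FinPoset n → FinPoset m → List (Elt n m) → Set
IsSemiantichain P Q S =
  Unique S ×
  (∀ z w → z ∈ S → w ∈ S → z ≢ w →
     ¬ (Σ (SubsetPQ _ _) λ U → IsUnichain P Q U × z ∈ₛ U × w ∈ₛ U))

IsUnichainCovering : ∀ {n m} → FinPoset n → FinPoset m → List (SubsetPQ n m) → Set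
IsUnichainCovering P Q Us =
  All (IsUnichain P Q) Us × (∀ z → Any (λ U → z ∈ₛ U) Us)

V-le : Fin 3 → Fin 3 → Bool
V-le zero _ = true
V-le (suc zero) (suc zero) = true
V-le (suc (suc zero)) (suc (suc zero)) = true
V-le _ _ = false

V : FinPoset 3
V = record { le = V-le ; refl = r ; antisym = a ; trans = t }
  where
  r : ∀ x → T (V-le x x)
  r zero = tt
  r (suc zero) = tt
  r (suc (suc zero)) = tt
  a : ∀ x y → T (V-le x y) → T (V-le y x) → x ≡ y
  a zero zero _ _ = _≡_.refl
  a (suc zero) (suc zero) _ _ = _≡_.refl
  a (suc (suc zero)) (suc (suc zero)) _ _ = _≡_.refl
  a zero (suc zero) _ ()
  a zero (suc (suc zero)) _ ()
  a (suc zero) zero () _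
  a (suc zero) (suc (suc zero)) () _
  a (suc (suc zero)) zero () _
  a (suc (suc zero)) (suc zero) () _
  t : ∀ x y z → T (V-le x y) → T (V-le y z) → T (V-le x z)
  t zero y z _ _ = tt
  t (suc zero) (suc zero) z _ q = q
  t (suc (suc zero)) (suc (suc zero)) z _ q = q
  t (suc zero) zero _ () _
  t (suc zero) (suc (suc zero)) _ () _
  t (suc (suc zero)) zero _ () _
  t (suc (suc zero)) (suc zero) _ () _

-- Call two elements of a product poset adjacent if they lie in a
-- common unichain: same first coordinate and comparable second ones, or
-- vice versa.  Every unichain is a clique of this graph, and any two
-- adjacent elements already form a unichain; so semiantichains are
-- exactly the duplicate-free lists that are independent in the graph.
--
--  * Upper bound 12: a verified branch-and-bound search shows that every
--    independent set of P × V has at most 12 elements.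
--  * Lower bound 13 (weighting argument): we put natural-number weights on
--    P × V of total 25 such that, again by the search, every clique (hence
--    every unichain) has weight at most 2.  A covering by k unichains has
--    weight at most 2k, so 25 ≤ 2k and k ≥ 13.
--  * An explicit independent list of 12 elements witnesses sharpness.
module Submission where

open import Defs
open import Data.Nat using (ℕ; suc; _≤_)
open import Data.Product using (Σ; _×_)
open import Data.List using (List; length)
open import Relation.Binary.PropositionalEquality using (_≡_)

open import Data.Nat using (_+_; _*_; _∸_; z≤n; _≤ᵇ_; _≡ᵇ_)
open import Data.Nat.Properties
  using (≤-refl; ≤-trans; ≤-reflexive; +-monoʳ-≤; +-mono-≤; m≤m+n; ≤ᵇ⇒≤; m+[n∸m]≡n;
         +-commutativeSemigroup; *-cancelʳ-<; module ≤-Reasoning)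
open import Data.Fin as Fin using (Fin; #_)
open import Data.Fin.Properties using (all?)
open import Data.Bool using (Bool; true; false; T; _∧_; _∨_; not; if_then_else_)
open import Data.Bool.Properties using (T-∧; T-∨)
open import Data.Unit using (tt)
open import Data.Empty using (⊥-elim)
open import Data.Sum as Sum using (_⊎_; inj₁; inj₂)
open import Data.Product using (_,_; proj₁; proj₂)
open import Data.Product.Properties using (≡-dec)
open import Data.List using ([]; _∷_; cartesianProduct; allFin)
open import Data.Bool.ListAction using (any)
open import Data.Vec using (Vec; lookup; _∷_; [])
open import Data.List.Relation.Unary.All as All using (All; []; _∷_)
open import Data.List.Relation.Unary.Any using (Any; here; there)
open import Data.List.Relation.Unary.Any.Properties using (any⁺)
open import Data.List.Relation.Unary.AllPairs using ([]; _∷_)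
open import Data.List.Relation.Unary.Unique.Propositional using (Unique)
open import Data.List.Membership.Propositional using (_∈_)
open import Data.List.Membership.Propositional.Properties using (∈-cartesianProduct⁺; ∈-allFin)
open import Function.Bundles using (Equivalence)
open import Algebra.Properties.CommutativeSemigroup +-commutativeSemigroup using (interchange; x∙yz≈y∙xz)
open import Relation.Binary.PropositionalEquality as ≡ using (_≢_; cong)
open import Relation.Nullary using (¬_; Dec; yes; no)
open import Relation.Nullary.Decidable
  using (isYes; toWitness; fromWitness; T?; _→-dec_; _⊎-dec_; _×-dec_; ¬?)

∧-intro : ∀ {a b} → T a → T b → T (a ∧ b)
∧-intro p q = Equivalence.from T-∧ (p , q)

∧-elim : ∀ {a b} → T (a ∧ b) → T a × T b
∧-elim = Equivalence.to T-∧

∨-intro : ∀ {a b} → T a ⊎ T b → T (a ∨ b)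
∨-intro = Equivalence.from T-∨

∨-elim : ∀ {a b} → T (a ∨ b) → T a ⊎ T b
∨-elim = Equivalence.to T-∨

not-elim : ∀ {a} → T (not a) → ¬ T a
not-elim {true} ()

module WeightedCliques {A : Set} (_≟_ : (x y : A) → Dec (x ≡ y))
                       (wt : A → ℕ) (R : A → A → Bool) where

  open import Data.List.Membership.DecPropositional _≟_ using (_∈?_)
  open ≤-Reasoning

  _⊆ᵇ_ : (A → Bool) → (A → Bool) → Set
  U ⊆ᵇ U′ = ∀ y → T (U y) → T (U′ y)

  IsClique : (A → Bool) → Set
  IsClique U = ∀ y z → T (U y) → T (U z) → y ≢ z → T (R y z)

  contribution : (A → Bool) → A → ℕ
  contribution U y = if U y then wt y else 0

  mass : (A → Bool) → List A → ℕ
  mass U []       = 0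
  mass U (y ∷ ys) = contribution U y + mass U ys

  everything : A → Bool
  everything _ = true

  contribution-mono : ∀ {U U′} → U ⊆ᵇ U′ → ∀ y → contribution U y ≤ contribution U′ y
  contribution-mono {U} {U′} U⊆U′ y with U y | U⊆U′ y
  ... | false | _   = z≤n
  ... | true  | U′y with U′ y | U′y tt
  ...   | true | _ = ≤-refl

  contribution-in : ∀ {U y} → T (U y) → contribution U y ≡ wt y
  contribution-in {U} {y} Uy with U y
  ... | true = ≡.refl

  contribution-out : ∀ {U y} → ¬ T (U y) → contribution U y ≡ 0
  contribution-out {U} {y} ¬Uy with U y
  ... | true  = ⊥-elim (¬Uy tt)
  ... | false = ≡.refl

  mass-mono : ∀ {U U′} → U ⊆ᵇ U′ → ∀ L → mass U L ≤ mass U′ L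
  mass-mono U⊆U′ []       = z≤n
  mass-mono U⊆U′ (y ∷ ys) = +-mono-≤ (contribution-mono U⊆U′ y) (mass-mono U⊆U′ ys)

  compatibleWith : A → A → Bool
  compatibleWith z y = isYes (y ≟ z) ∨ R z y

  clique⊆compatible : ∀ {U z} → IsClique U → T (U z) → U ⊆ᵇ compatibleWith z
  clique⊆compatible {U} {z} clq Uz y Uy with y ≟ z
  ... | yes _  = tt
  ... | no y≢z = clq z y Uz Uy (λ z≡y → y≢z (≡.sym z≡y))

  -- Either all candidates together fit, or we branch on the head z of L:
  -- cliques avoiding z, and cliques containing z (whose other members are
  -- compatible with z, and must fit into the remaining budget k ∸ wt z).
  fits : ℕ → (A → Bool) → List A → Bool
  fits k g []       = true
  fits k g (z ∷ zs) =
    (mass g (z ∷ zs) ≤ᵇ k) ∨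
    (fits k g zs ∧ (not (g z) ∨ ((wt z ≤ᵇ k) ∧ fits (k ∸ wt z) (λ y → g y ∧ compatibleWith z y) zs)))

  fits-sound : ∀ k g L U → T (fits k g L) → IsClique U → U ⊆ᵇ g → mass U L ≤ k
  fits-sound k g []       U _  _   _   = z≤n
  fits-sound k g (z ∷ zs) U ok clq U⊆g with ∨-elim {mass g (z ∷ zs) ≤ᵇ k} ok
  ... | inj₁ allFit = ≤-trans (mass-mono U⊆g (z ∷ zs)) (≤ᵇ⇒≤ _ k allFit)
  ... | inj₂ branch with ∧-elim {fits k g zs} branch | T? (U z)
  ...   | excluded , _ | no z∉U = begin
    mass U (z ∷ zs)              ≡⟨ cong (_+ mass U zs) (contribution-out {U} z∉U) ⟩
    mass U zs                    ≤⟨ fits-sound k g zs U excluded clq U⊆g ⟩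
    k                            ∎
  ...   | _ , included | yes z∈U with ∨-elim {not (g z)} included
  ...     | inj₁ ¬gz = ⊥-elim (not-elim ¬gz (U⊆g z z∈U))
  ...     | inj₂ incl with ∧-elim {wt z ≤ᵇ k} incl
  ...       | wz≤k , restOk = begin
    mass U (z ∷ zs)              ≡⟨ cong (_+ mass U zs) (contribution-in {U} z∈U) ⟩
    wt z + mass U zs             ≤⟨ +-monoʳ-≤ (wt z) restFits ⟩
    wt z + (k ∸ wt z)            ≡⟨ m+[n∸m]≡n (≤ᵇ⇒≤ (wt z) k wz≤k) ⟩
    k                            ∎
    where
    restFits : mass U zs ≤ k ∸ wt z
    restFits = fits-sound (k ∸ wt z) _ zs U restOk clq
      (λ y Uy → ∧-intro (U⊆g y Uy) (clique⊆compatible {U} clq z∈U y Uy))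

  contribution-∪ : ∀ U U′ y → contribution (λ v → U v ∨ U′ v) y ≤ contribution U y + contribution U′ y
  contribution-∪ U U′ y with U y | U′ y
  ... | true  | _     = m≤m+n (wt y) _
  ... | false | true  = ≤-refl
  ... | false | false = z≤n

  mass-∪ : ∀ U U′ L → mass (λ y → U y ∨ U′ y) L ≤ mass U L + mass U′ L
  mass-∪ U U′ []       = z≤n
  mass-∪ U U′ (y ∷ ys) = begin
    mass (λ v → U v ∨ U′ v) (y ∷ ys)
      ≤⟨ +-mono-≤ (contribution-∪ U U′ y) (mass-∪ U U′ ys) ⟩
    (contribution U y + contribution U′ y) + (mass U ys + mass U′ ys)
      ≡⟨ interchange (contribution U y) (contribution U′ y) (mass U ys) (mass U′ ys) ⟩
    mass U (y ∷ ys) + mass U′ (y ∷ ys) ∎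

  mass-gain : ∀ {U U′ x L} → U′ ⊆ᵇ U → T (U x) → ¬ T (U′ x) → x ∈ L →
              wt x + mass U′ L ≤ mass U L
  mass-gain {U} {U′} {x} {_ ∷ ys} U′⊆U Ux ¬U′x (here ≡.refl) = begin
    wt x + (contribution U′ x + mass U′ ys) ≡⟨ cong (λ c → wt x + (c + mass U′ ys)) (contribution-out {U′} ¬U′x) ⟩
    wt x + mass U′ ys                       ≤⟨ +-monoʳ-≤ (wt x) (mass-mono U′⊆U ys) ⟩
    wt x + mass U ys                        ≡⟨ cong (_+ mass U ys) (≡.sym (contribution-in {U} Ux)) ⟩
    mass U (x ∷ ys)                         ∎
  mass-gain {U} {U′} {x} {y ∷ ys} U′⊆U Ux ¬U′x (there x∈ys) = begin
    wt x + (contribution U′ y + mass U′ ys) ≡⟨ x∙yz≈y∙xz (wt x) (contribution U′ y) (mass U′ ys) ⟩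
    contribution U′ y + (wt x + mass U′ ys) ≤⟨ +-mono-≤ (contribution-mono U′⊆U y) (mass-gain {U} {U′} U′⊆U Ux ¬U′x x∈ys) ⟩
    mass U (y ∷ ys)                         ∎

  member : List A → A → Bool
  member S y = isYes (y ∈? S)

  unique-length≤mass : (∀ x → 1 ≤ wt x) → ∀ L {S} → Unique S → All (_∈ L) S →
                       length S ≤ mass (member S) L
  unique-length≤mass positive L []               []             = z≤n
  unique-length≤mass positive L {x ∷ xs} (x∉xs ∷ unique) (x∈L ∷ xs⊆L) = begin
    suc (length xs)              ≤⟨ +-mono-≤ (positive x) (unique-length≤mass positive L unique xs⊆L) ⟩
    wt x + mass (member xs) L    ≤⟨ mass-gain {member (x ∷ xs)} {member xs} member-grows
                                      (fromWitness (here ≡.refl)) x∉member x∈L ⟩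
    mass (member (x ∷ xs)) L     ∎
    where
    member-grows : member xs ⊆ᵇ member (x ∷ xs)
    member-grows y y∈xs = fromWitness (there (toWitness y∈xs))
    x∉member : ¬ T (member xs x)
    x∉member x∈xs = All.lookup x∉xs (toWitness x∈xs) ≡.refl

  coveredBy : List (A → Bool) → A → Bool
  coveredBy Us y = any (λ U → U y) Us

  mass-nothing : ∀ L → mass (λ _ → false) L ≡ 0
  mass-nothing []       = ≡.refl
  mass-nothing (_ ∷ ys) = mass-nothing ys

  mass-coveredBy : ∀ c L Us → All (λ U → mass U L ≤ c) Us → mass (coveredBy Us) L ≤ length Us * c
  mass-coveredBy c L []       []         = ≤-reflexive (mass-nothing L)
  mass-coveredBy c L (U ∷ Us) (U≤c ∷ Us≤c) =
    ≤-trans (mass-∪ U (coveredBy Us) L) (+-mono-≤ U≤c (mass-coveredBy c L Us Us≤c))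

  covering-mass-bound : ∀ c L Us → All (λ U → mass U L ≤ c) Us →
                        (∀ y → Any (λ U → T (U y)) Us) → mass everything L ≤ length Us * c
  covering-mass-bound c L Us Us≤c covers =
    ≤-trans (mass-mono (λ y _ → any⁺ (λ U → U y) (covers y)) L) (mass-coveredBy c L Us Us≤c)

comparable-pair : ∀ {k} (X : FinPoset k) {a b s t} → Comparable X a b →
                  s ≡ a ⊎ s ≡ b → t ≡ a ⊎ t ≡ b → Comparable X s t
comparable-pair X {a} ab (inj₁ ≡.refl) (inj₁ ≡.refl) = inj₁ (FinPoset.refl X a)
comparable-pair X     ab (inj₁ ≡.refl) (inj₂ ≡.refl) = ab
comparable-pair X     ab (inj₂ ≡.refl) (inj₁ ≡.refl) = Sum.swap ab
comparable-pair X {_} {b} ab (inj₂ ≡.refl) (inj₂ ≡.refl) = inj₁ (FinPoset.refl X b)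

module ProductGraph {n m} (P : FinPoset n) (Q : FinPoset m) where

  _≟ₑ_ : (z w : Elt n m) → Dec (z ≡ w)
  _≟ₑ_ = ≡-dec Fin._≟_ Fin._≟_

  comparable? : ∀ {k} (X : FinPoset k) x y → Dec (Comparable X x y)
  comparable? X x y = T? (le X x y) ⊎-dec T? (le X y x)

  Adjacent : Elt n m → Elt n m → Set
  Adjacent (u , x) (v , y) = (u ≡ v × Comparable Q x y) ⊎ (x ≡ y × Comparable P u v)

  adjacent? : ∀ z w → Dec (Adjacent z w)
  adjacent? (u , x) (v , y) = (u Fin.≟ v ×-dec comparable? Q x y) ⊎-dec (x Fin.≟ y ×-dec comparable? P u v)

  adjacent nonadjacent : Elt n m → Elt n m → Bool
  adjacent    z w = isYes (adjacent? z w)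
  nonadjacent z w = isYes (¬? (adjacent? z w))

  unichain⇒adjacent : ∀ {U} → IsUnichain P Q U → ∀ z w → z ∈ₛ U → w ∈ₛ U → Adjacent z w
  unichain⇒adjacent (inj₁ ((p , inRow) , chain)) z w z∈U w∈U =
    inj₁ (≡.trans (inRow z z∈U) (≡.sym (inRow w w∈U)) , chain z w z∈U w∈U)
  unichain⇒adjacent (inj₂ ((q , inColumn) , chain)) z w z∈U w∈U =
    inj₂ (≡.trans (inColumn z z∈U) (≡.sym (inColumn w w∈U)) , chain z w z∈U w∈U)

  pairSet : Elt n m → Elt n m → SubsetPQ n m
  pairSet z w t = isYes (t ≟ₑ z) ∨ isYes (t ≟ₑ w)

  pairSet-members : ∀ {z w t} → t ∈ₛ pairSet z w → t ≡ z ⊎ t ≡ w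
  pairSet-members {z} {w} {t} t∈ = Sum.map toWitness toWitness (∨-elim {isYes (t ≟ₑ z)} t∈)

  adjacent⇒unichain : ∀ z w → Adjacent z w →
                      Σ (SubsetPQ n m) λ U → IsUnichain P Q U × z ∈ₛ U × w ∈ₛ U
  adjacent⇒unichain z w zw =
    pairSet z w , pairUnichain zw ,
    ∨-intro {isYes (z ≟ₑ z)} (inj₁ (fromWitness ≡.refl)) , ∨-intro {isYes (w ≟ₑ z)} (inj₂ (fromWitness ≡.refl))
    where
    sameAs : ∀ {A : Set} (f : Elt n m → A) → f z ≡ f w → ∀ t → t ∈ₛ pairSet z w → f t ≡ f z
    sameAs f fz≡fw t t∈ with pairSet-members {z} {w} {t} t∈
    ... | inj₁ ≡.refl = ≡.refl
    ... | inj₂ ≡.refl = ≡.sym fz≡fw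
    chainIn : ∀ {k} (X : FinPoset k) (f : Elt n m → Fin k) → Comparable X (f z) (f w) →
              ∀ s t → s ∈ₛ pairSet z w → t ∈ₛ pairSet z w → Comparable X (f s) (f t)
    chainIn X f fzw s t s∈ t∈ = comparable-pair X fzw
      (Sum.map (cong f) (cong f) (pairSet-members {z} {w} s∈))
      (Sum.map (cong f) (cong f) (pairSet-members {z} {w} t∈))
    pairUnichain : Adjacent z w → IsUnichain P Q (pairSet z w)
    pairUnichain (inj₁ (same , cmp)) = inj₁ ((proj₁ z , sameAs proj₁ same) , chainIn Q proj₂ cmp)
    pairUnichain (inj₂ (same , cmp)) = inj₂ ((proj₂ z , sameAs proj₂ same) , chainIn P proj₁ cmp)

  semiantichain⇒nonadjacent : ∀ {S} → IsSemiantichain P Q S →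
                              ∀ z w → z ∈ S → w ∈ S → z ≢ w → T (nonadjacent z w)
  semiantichain⇒nonadjacent (_ , separated) z w z∈S w∈S z≢w =
    fromWitness (λ zw → separated z w z∈S w∈S z≢w (adjacent⇒unichain z w zw))

  nonadjacent⇒semiantichain : ∀ {S} → Unique S →
                              (∀ z w → z ∈ S → w ∈ S → z ≢ w → T (nonadjacent z w)) →
                              IsSemiantichain P Q S
  nonadjacent⇒semiantichain unique independent =
    unique , λ z w z∈S w∈S z≢w (U , isU , z∈U , w∈U) →
      toWitness (independent z w z∈S w∈S z≢w) (unichain⇒adjacent isU z w z∈U w∈U)

  elements : List (Elt n m)
  elements = cartesianProduct (allFin n) (allFin m)

  ∈-elements : ∀ z → z ∈ elements
  ∈-elements (u , x) = ∈-cartesianProduct⁺ (∈-allFin u) (∈-allFin x)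

  module Independent = WeightedCliques _≟ₑ_ (λ _ → 1) nonadjacent
  module Weighted (wt : Elt n m → ℕ) = WeightedCliques _≟ₑ_ wt adjacent

  semiantichain-bound : ∀ k → T (Independent.fits k Independent.everything elements) →
                        ∀ S → IsSemiantichain P Q S → length S ≤ k
  semiantichain-bound k ok S semi@(unique , _) =
    ≤-trans (Independent.unique-length≤mass (λ _ → ≤-refl) elements unique
               (All.tabulate λ {z} _ → ∈-elements z))
            (Independent.fits-sound k _ elements (Independent.member S) ok independent (λ _ _ → tt))
    where
    independent : Independent.IsClique (Independent.member S)
    independent y z y∈S z∈S = semiantichain⇒nonadjacent semi y z (toWitness y∈S) (toWitness z∈S)

  covering-bound : ∀ wt c → T (Weighted.fits wt c (Weighted.everything wt) elements) →
                   ∀ Us → IsUnichainCovering P Q Us →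
                   Weighted.mass wt (Weighted.everything wt) elements ≤ length Us * c
  covering-bound wt c ok Us (unichains , covers) =
    Weighted.covering-mass-bound wt c elements Us (All.map light unichains) covers
    where
    light : ∀ {U} → IsUnichain P Q U → Weighted.mass wt U elements ≤ c
    light {U} isU = Weighted.fits-sound wt c _ elements U ok
      (λ y z y∈U z∈U _ → fromWitness (unichain⇒adjacent isU y z y∈U z∈U)) (λ _ _ → tt)

-- The nine-element poset P: the reflexive closure of the strict relations
-- listed below (already transitively closed).  Its Hasse diagram has the
-- covers 0<4, 0<7, 0<8, 1<6, 1<7, 2<6, 2<7, 3<5, 3<6, 3<8, 5<7.
strictlyBelow : List (ℕ × ℕ)
strictlyBelow =
  (0 , 4) ∷ (0 , 7) ∷ (0 , 8) ∷ (1 , 6) ∷ (1 , 7) ∷ (2 , 6) ∷ (2 , 7) ∷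
  (3 , 5) ∷ (3 , 6) ∷ (3 , 7) ∷ (3 , 8) ∷ (5 , 7) ∷ []

leP : Fin 9 → Fin 9 → Bool
leP u v = isYes (u Fin.≟ v) ∨ any (λ { (a , b) → (Fin.toℕ u ≡ᵇ a) ∧ (Fin.toℕ v ≡ᵇ b) }) strictlyBelow

P₉ : FinPoset 9
P₉ = record
  { le      = leP
  ; refl    = toWitness {a? = all? λ x → T? (leP x x)} tt
  ; antisym = toWitness {a? = all? λ x → all? λ y →
                T? (leP x y) →-dec T? (leP y x) →-dec x Fin.≟ y} tt
  ; trans   = toWitness {a? = all? λ x → all? λ y → all? λ z →
                T? (leP x y) →-dec T? (leP y z) →-dec T? (leP x z)} tt
  }

open ProductGraph P₉ V
open import Data.List.Relation.Unary.Unique.DecPropositional _≟ₑ_ using (unique?)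

-- Weights on P × V for the weighting argument: total 25, and every
-- unichain has weight at most 2.  Row p lists the weights of (p,0),(p,1),(p,2).
weights : Vec (Vec ℕ 3) 9
weights =
  (1 ∷ 1 ∷ 1 ∷ []) ∷ (0 ∷ 2 ∷ 2 ∷ []) ∷ (0 ∷ 2 ∷ 2 ∷ []) ∷ (0 ∷ 1 ∷ 1 ∷ []) ∷ (1 ∷ 1 ∷ 1 ∷ []) ∷
  (1 ∷ 1 ∷ 1 ∷ []) ∷ (2 ∷ 0 ∷ 0 ∷ []) ∷ (1 ∷ 0 ∷ 0 ∷ []) ∷ (1 ∷ 1 ∷ 1 ∷ []) ∷ []

weight : Elt 9 3 → ℕ
weight (p , x) = lookup (lookup weights p) x

semiantichain≤12 : ∀ S → IsSemiantichain P₉ V S → length S ≤ 12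
semiantichain≤12 = semiantichain-bound 12 tt

covering≥13 : ∀ Us → IsUnichainCovering P₉ V Us → 13 ≤ length Us
-- 25 ≤ 2 · |Us| forces |Us| ≥ 13.
covering≥13 Us covering = *-cancelʳ-< 2 12 (length Us) (covering-bound weight 2 tt Us covering)

-- A semiantichain of size 12: the minimal elements 0,1,2,3 of P paired with
-- the bottom of V, and the elements 4,5,6,8 paired with both tops of V.
S₁₂ : List (Elt 9 3)
S₁₂ = (# 0 , # 0) ∷ (# 1 , # 0) ∷ (# 2 , # 0) ∷ (# 3 , # 0) ∷
      (# 4 , # 1) ∷ (# 4 , # 2) ∷ (# 5 , # 1) ∷ (# 5 , # 2) ∷
      (# 6 , # 1) ∷ (# 6 , # 2) ∷ (# 8 , # 1) ∷ (# 8 , # 2) ∷ []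

NonadjacentToOthers : Elt 9 3 → Set
NonadjacentToOthers z = All (λ w → z ≡ w ⊎ T (nonadjacent z w)) S₁₂

nonadjacentToOthers? : ∀ z → Dec (NonadjacentToOthers z)
nonadjacentToOthers? z = All.all? (λ w → (z ≟ₑ w) ⊎-dec T? (nonadjacent z w)) S₁₂

S₁₂-independent : ∀ z w → z ∈ S₁₂ → w ∈ S₁₂ → z ≢ w → T (nonadjacent z w)
S₁₂-independent z w z∈ w∈ z≢w =
  Sum.[ (λ z≡w → ⊥-elim (z≢w z≡w)) , (λ zw → zw) ] (All.lookup (All.lookup pairwise z∈) w∈)
  where
  pairwise : All NonadjacentToOthers S₁₂
  pairwise = toWitness {a? = All.all? nonadjacentToOthers? S₁₂} tt

S₁₂-semiantichain : IsSemiantichain P₉ V S₁₂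
S₁₂-semiantichain = nonadjacent⇒semiantichain (toWitness {a? = unique? S₁₂} tt) S₁₂-independent

mainTheorem8 :
    (Σ (FinPoset 9) λ P →
        (Σ (List (Elt 9 3)) λ S → IsSemiantichain P V S × length S ≡ 12)
      × (∀ S → IsSemiantichain P V S → length S ≤ 12)
      × (∀ Us → IsUnichainCovering P V Us → 13 ≤ length Us))
    ×
    (Σ ℕ λ n → Σ ℕ λ m → Σ (FinPoset n) λ P → Σ (FinPoset m) λ Q → Σ ℕ λ k →
        (∀ S → IsSemiantichain P Q S → length S ≤ k)
      × (∀ Us → IsUnichainCovering P Q Us → suc k ≤ length Us))
mainTheorem8 =
  (P₉ , (S₁₂ , S₁₂-semiantichain , ≡.refl) , semiantichain≤12 , covering≥13) ,
  (9 , 3 , P₉ , V , 12 , semiantichain≤12 , covering≥13)
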